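{- Let $x_1,\dotsc,x_{m-1}$ be odd positive integers. Given a prime number $p$, let $V_p=\max_{i\in[m-1]}\{v_p(x_i)\}$, and for an odd positive integer $x_m$ let $y=\gcd(\sigma_{m-1}(x_1,\dotsc,x_m),x_1\dotsm x_m)$. The following statements are equivalent: (a) There exists an odd positive integer $x_m$ such that $v_p(y)=v_p(x_1\dotsm x_{m-1})-V_p$ for every prime number $p$ that divides $x_i$ for some $i\in[m-1]$. (b) There exists an odd positive integer $x_m$ such that $v_p(y)=v_p(x_1\dotsm x_{m-1})+V_p$ for every prime number $p$ that divides $x_i$ for some $i\in[m-1]$. (c) For every prime number $p$ that divides $x_i$ for some $i\in[m-1]$, we have that $p$ does not divide \[ \sum_{i=1}^{m-1}p^{V_p-v_p(x_i)}\prod_{\substack{1\leq j\leq m-1\\ j\neq i}}\frac{x_j}{p^{v_p(x_j)}}. \]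
   Context: Here $[m]=\{1,\dotsc,m\}$, $\sigma_{m-1}(x_1,\dotsc,x_m)=\sum_{I\subseteq[m],\,|I|=m-1}\prod_{i\in I}x_i$ is the elementary symmetric polynomial of degree $m-1$, and $v_p(n)$ denotes the $p$-adic valuation of $n$ (the exponent of the largest power of $p$ dividing $n$). -}

module Defs where

open import Data.Nat using (ℕ; zero; suc; _+_; _*_; _∸_; _^_; _⊔_; _/_; NonZero)
open import Data.Nat.Properties using (m^n≢0)
open import Data.Nat.Divisibility using (_∣_; _∣?_)
open import Data.Fin using (Fin; zero; suc; _≟_)
open import Relation.Nullary using (¬_; yes; no)

Odd : ℕ → Set
Odd n = ¬ (2 ∣ n)

-- Computed by repeated division (fuel n is sufficient since p ≥ 2).
-- Conventions for degenerate inputs (p < 2 or n = 0) are irrelevant here: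
-- it is only applied to primes p and positive n.
vp : ℕ → ℕ → ℕ
vp zero n = 0
vp (suc zero) n = 0
vp p@(suc (suc q)) n = go n n
  where
  go : ℕ → ℕ → ℕ
  go zero k = 0
  go (suc f) zero = 0
  go (suc f) k@(suc _) with p ∣? k
  ... | yes _ = suc (go f (k / p))
  ... | no _ = 0

pfree : ℕ → ℕ → ℕ
pfree zero x = x
pfree p@(suc q) x = _/_ x (p ^ vp p x) {{m^n≢0 p (vp p x)}}

sumF : ∀ {n} → (Fin n → ℕ) → ℕ
sumF {zero} f = 0
sumF {suc n} f = f zero + sumF (λ i → f (suc i))

prodF : ∀ {n} → (Fin n → ℕ) → ℕ
prodF {zero} f = 1
prodF {suc n} f = f zero * prodF (λ i → f (suc i))

maxF : ∀ {n} → (Fin n → ℕ) → ℕ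
maxF {zero} f = 0
maxF {suc n} f = f zero ⊔ maxF (λ i → f (suc i))

prodExcept : ∀ {n} → Fin n → (Fin n → ℕ) → ℕ
prodExcept i f = prodF (λ j → if-eq j)
  where
  if-eq : _ → ℕ
  if-eq j with i ≟ j
  ... | yes _ = 1
  ... | no _ = f j

-- elementary symmetric polynomial of degree N-1 in N variables:
-- the sum over all (N-1)-subsets I of [N] of ∏_{i∈I} x_i, i.e. the sum over
-- the omitted index k of ∏_{i≠k} x_i.
σprev : ∀ {N} → (Fin N → ℕ) → ℕ
σprev x = sumF (λ k → prodExcept k x)

snoc : ∀ {n} → (Fin n → ℕ) → ℕ → Fin (suc n) → ℕ
snoc {zero} x a zero = a
snoc {suc n} x a zero = x zero
snoc {suc n} x a (suc i) = snoc (λ j → x (suc j)) a i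

Vp : ∀ {n} → ℕ → (Fin n → ℕ) → ℕ
Vp p x = maxF (λ i → vp p (x i))

{-# OPTIONS --safe #-}
-- Write Π = x₁⋯x_{m-1} and e = σ_{m-2}(x₁,…,x_{m-1}), so that σ_{m-1}(x) = Π + x_m e
-- and y = gcd(Π + x_m e, Π x_m). For a prime p dividing some xᵢ, with s = v_p(Π) and
-- V = V_p ≥ 1, factoring out the p-parts of the xᵢ gives e p^V = p^s T, where T is
-- the sum in (c); hence e = p^(s-V) T. If p ∣ T then p^(s-V+1) divides Π and e, so
-- v_p(y) > s - V for every x_m; and v_p(y) = s + V forces p^V ∣ x_m, whence
-- p^(s+1) ∣ x_m e and so p^(s+1) ∣ Π, which is absurd. Conversely if p ∤ T for all
-- such p, then x_m = 1 gives y = gcd(Π, e) with v_p = s - V, while with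
-- g = gcd(Π, e), Π = g L, e = g E and x_m = L t for an odd t with t E ≡ -1 (mod L)
-- one gets y = Π L, and v_p(L) = s - (s - V) = V.
module Submission where

open import Defs
open import Data.Fin using (Fin; zero; suc; _≟_)
open import Data.Nat
  using (ℕ; zero; suc; _+_; _*_; _∸_; _^_; _<_; _≤_; z≤n; s≤s; z<s; _/_; NonZero; >-nonZero)
open import Data.Nat.Properties hiding (_≟_)
open import Data.Nat.Divisibility
open import Data.Nat.DivMod using (m/n*n≡m; m*n/n≡m; m/n<m)
open import Data.Nat.GCD
open import Data.Nat.Coprimality using (Coprime; coprime-/gcd; coprime-Bézout; coprime-divisor)
open import Data.Nat.Primality using (Prime; euclidsLemma; prime[2]; ¬prime[1]; prime⇒nonZero)
open import Data.Nat.Tactic.RingSolver using (solve-∀)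
open import Data.Product using (Σ; ∃; _×_; _,_; proj₁; proj₂)
open import Data.Sum using (inj₁; inj₂; [_,_]′)
open import Function.Base using (_∘′_; case_of_)
open import Function.Bundles using (_⇔_; mk⇔)
open import Relation.Nullary using (¬_; yes; no; contradiction)
open import Relation.Binary.PropositionalEquality
open import Algebra.Properties.CommutativeSemigroup *-commutativeSemigroup
  using () renaming (interchange to *-interchange)

sumF-cong : ∀ {n} {f g : Fin n → ℕ} → (∀ i → f i ≡ g i) → sumF f ≡ sumF g
sumF-cong {zero} eq = refl
sumF-cong {suc n} eq = cong₂ _+_ (eq zero) (sumF-cong (λ i → eq (suc i)))

prodF-cong : ∀ {n} {f g : Fin n → ℕ} → (∀ i → f i ≡ g i) → prodF f ≡ prodF g
prodF-cong {zero} eq = refl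
prodF-cong {suc n} eq = cong₂ _*_ (eq zero) (prodF-cong (λ i → eq (suc i)))

*-distribˡ-sumF : ∀ {n} c (f : Fin n → ℕ) → c * sumF f ≡ sumF (λ i → c * f i)
*-distribˡ-sumF {zero} c f = *-zeroʳ c
*-distribˡ-sumF {suc n} c f =
  trans (*-distribˡ-+ c (f zero) _) (cong (c * f zero +_) (*-distribˡ-sumF c (λ i → f (suc i))))

*-distribʳ-sumF : ∀ {n} c (f : Fin n → ℕ) → sumF f * c ≡ sumF (λ i → f i * c)
*-distribʳ-sumF c f = trans (*-comm _ c) (trans (*-distribˡ-sumF c f) (sumF-cong (λ i → *-comm c (f i))))

prodF-distrib-* : ∀ {n} (f g : Fin n → ℕ) → prodF (λ i → f i * g i) ≡ prodF f * prodF g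
prodF-distrib-* {zero} f g = refl
prodF-distrib-* {suc n} f g =
  trans (cong (f zero * g zero *_) (prodF-distrib-* (λ i → f (suc i)) (λ i → g (suc i))))
        (*-interchange (f zero) (g zero) _ _)

prodF-^ : ∀ {n} p (v : Fin n → ℕ) → prodF (λ i → p ^ v i) ≡ p ^ sumF v
prodF-^ {zero} p v = refl
prodF-^ {suc n} p v =
  trans (cong (p ^ v zero *_) (prodF-^ p (λ i → v (suc i)))) (sym (^-distribˡ-+-* p (v zero) _))

prodF-pos : ∀ {n} (f : Fin n → ℕ) → (∀ i → 0 < f i) → 0 < prodF f
prodF-pos {zero} f f>0 = z<s
prodF-pos {suc n} f f>0 = *-mono-< (f>0 zero) (prodF-pos (λ i → f (suc i)) (λ i → f>0 (suc i)))

prime∤prodF : ∀ {n p} (f : Fin n → ℕ) → Prime p → (∀ i → ¬ p ∣ f i) → ¬ p ∣ prodF f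
prime∤prodF {zero} f p-prime p∤f p∣1 = ¬prime[1] (subst Prime (∣1⇒≡1 p∣1) p-prime)
prime∤prodF {suc n} f p-prime p∤f p∣f with euclidsLemma (f zero) _ p-prime p∣f
... | inj₁ p∣f₀ = p∤f zero p∣f₀
... | inj₂ p∣rest = prime∤prodF (λ i → f (suc i)) p-prime (λ i → p∤f (suc i)) p∣rest

≤-maxF : ∀ {n} (v : Fin n → ℕ) i → v i ≤ maxF v
≤-maxF v zero = m≤m⊔n _ _
≤-maxF v (suc i) = ≤-trans (≤-maxF (λ j → v (suc j)) i) (m≤n⊔m (v zero) _)

maxF≤sumF : ∀ {n} (v : Fin n → ℕ) → maxF v ≤ sumF v
maxF≤sumF {zero} v = z≤n
maxF≤sumF {suc n} v = ⊔-lub (m≤m+n _ _) (≤-trans (maxF≤sumF (λ j → v (suc j))) (m≤n+m _ (v zero)))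

prodF-snoc : ∀ {n} (x : Fin n → ℕ) a → prodF (snoc x a) ≡ prodF x * a
prodF-snoc {zero} x a = *-comm a 1
prodF-snoc {suc n} x a =
  trans (cong (x zero *_) (prodF-snoc (λ j → x (suc j)) a)) (sym (*-assoc (x zero) _ a))

-- prodExcept is defined through a helper local to Defs and out of scope here;
-- the metavariable exceptAt is solved by unification against that helper, so
-- that its values can be reasoned about pointwise.
mutual
  exceptAt : ∀ {n} → Fin n → (Fin n → ℕ) → Fin n → ℕ
  exceptAt = _

  private
    solve-exceptAt : ∀ {n} (i : Fin n) f → prodExcept i f ≡ prodF (exceptAt i f)
    solve-exceptAt i f = refl

prodExcept-zero : ∀ {n} (f : Fin (suc n) → ℕ) → prodExcept zero f ≡ prodF (λ j → f (suc j))
prodExcept-zero f = +-identityʳ _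

prodExcept-suc : ∀ {n} (i : Fin n) (f : Fin (suc n) → ℕ) →
                 prodExcept (suc i) f ≡ f zero * prodExcept i (λ j → f (suc j))
prodExcept-suc i f = cong (f zero *_) (prodF-cong exceptAt-suc)
  where
  exceptAt-suc : ∀ j → exceptAt (suc i) f (suc j) ≡ exceptAt i (λ k → f (suc k)) j
  exceptAt-suc j with i ≟ j
  ... | yes _ = refl
  ... | no _ = refl

prodExcept-cong : ∀ {n} (i : Fin n) {f g : Fin n → ℕ} → (∀ j → f j ≡ g j) → prodExcept i f ≡ prodExcept i g
prodExcept-cong i {f} {g} f≗g = prodF-cong exceptAt-cong
  where
  exceptAt-cong : ∀ j → exceptAt i f j ≡ exceptAt i g j
  exceptAt-cong j with i ≟ j
  ... | yes _ = refl
  ... | no _ = f≗g j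

prodExcept-distrib-* : ∀ {n} (i : Fin n) (f g : Fin n → ℕ) →
                       prodExcept i (λ j → f j * g j) ≡ prodExcept i f * prodExcept i g
prodExcept-distrib-* i f g = trans (prodF-cong exceptAt-*) (prodF-distrib-* (exceptAt i f) (exceptAt i g))
  where
  exceptAt-* : ∀ j → exceptAt i (λ j → f j * g j) j ≡ exceptAt i f j * exceptAt i g j
  exceptAt-* j with i ≟ j
  ... | yes _ = refl
  ... | no _ = refl

prodExcept*f≡prodF : ∀ {n} (i : Fin n) (f : Fin n → ℕ) → prodExcept i f * f i ≡ prodF f
prodExcept*f≡prodF zero f = trans (cong (_* f zero) (prodExcept-zero f)) (*-comm _ (f zero))
prodExcept*f≡prodF (suc i) f = begin
  prodExcept (suc i) f * f (suc i)                          ≡⟨ cong (_* f (suc i)) (prodExcept-suc i f) ⟩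
  f zero * prodExcept i (λ j → f (suc j)) * f (suc i)        ≡⟨ *-assoc (f zero) _ _ ⟩
  f zero * (prodExcept i (λ j → f (suc j)) * f (suc i))      ≡⟨ cong (f zero *_) (prodExcept*f≡prodF i (λ j → f (suc j))) ⟩
  prodF f                                                    ∎
  where open ≡-Reasoning

σprev-suc : ∀ {n} (f : Fin (suc n) → ℕ) → σprev f ≡ prodF (λ j → f (suc j)) + f zero * σprev (λ j → f (suc j))
σprev-suc f = cong₂ _+_ (prodExcept-zero f)
  (trans (sumF-cong (λ k → prodExcept-suc k f)) (sym (*-distribˡ-sumF (f zero) (λ k → prodExcept k (λ j → f (suc j))))))

σprev-snoc : ∀ {n} (x : Fin n → ℕ) a → σprev (snoc x a) ≡ prodF x + a * σprev x
σprev-snoc {zero} x a = σprev-suc (snoc x a)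
σprev-snoc {suc n} x a = begin
  σprev (snoc x a)                                   ≡⟨ σprev-suc (snoc x a) ⟩
  prodF (snoc x′ a) + x zero * σprev (snoc x′ a)      ≡⟨ cong₂ (λ u w → u + x zero * w) (prodF-snoc x′ a) (σprev-snoc x′ a) ⟩
  prodF x′ * a + x zero * (prodF x′ + a * σprev x′)   ≡⟨ regroup (prodF x′) a (x zero) (σprev x′) ⟩
  x zero * prodF x′ + a * (prodF x′ + x zero * σprev x′) ≡⟨ cong (λ w → x zero * prodF x′ + a * w) (sym (σprev-suc x)) ⟩
  prodF x + a * σprev x                              ∎
  where
  open ≡-Reasoning
  x′ : Fin n → ℕ
  x′ j = x (suc j)
  regroup : ∀ Π a x₀ e → Π * a + x₀ * (Π + a * e) ≡ x₀ * Π + a * (Π + x₀ * e)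
  regroup = solve-∀

σprev-cong : ∀ {n} {f g : Fin n → ℕ} → (∀ i → f i ≡ g i) → σprev f ≡ σprev g
σprev-cong f≗g = sumF-cong (λ k → prodExcept-cong k f≗g)

σprev-^* : ∀ {n} p (v u : Fin n → ℕ) {V} → (∀ i → v i ≤ V) →
  σprev (λ i → p ^ v i * u i) * p ^ V ≡ p ^ sumF v * sumF (λ i → p ^ (V ∸ v i) * prodExcept i u)
σprev-^* {n} p v u {V} v≤V = begin
  σprev f * p ^ V                                                   ≡⟨ *-distribʳ-sumF (p ^ V) (λ i → prodExcept i f) ⟩
  sumF (λ i → prodExcept i f * p ^ V)                               ≡⟨ sumF-cong term ⟩
  sumF (λ i → p ^ sumF v * (p ^ (V ∸ v i) * prodExcept i u))
    ≡⟨ sym (*-distribˡ-sumF (p ^ sumF v) (λ i → p ^ (V ∸ v i) * prodExcept i u)) ⟩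
  p ^ sumF v * sumF (λ i → p ^ (V ∸ v i) * prodExcept i u)           ∎
  where
  open ≡-Reasoning
  f : Fin n → ℕ
  f i = p ^ v i * u i
  term : ∀ i → prodExcept i f * p ^ V ≡ p ^ sumF v * (p ^ (V ∸ v i) * prodExcept i u)
  term i = begin
    prodExcept i f * p ^ V                     ≡⟨ cong₂ _*_ (prodExcept-distrib-* i (λ j → p ^ v j) u) pⱽ≡ ⟩
    (A * B) * (p ^ v i * p ^ (V ∸ v i))        ≡⟨ *-interchange A B _ _ ⟩
    (A * p ^ v i) * (B * p ^ (V ∸ v i))        ≡⟨ cong₂ _*_ Apᵛⁱ≡pˢ (*-comm B _) ⟩
    p ^ sumF v * (p ^ (V ∸ v i) * B)           ∎
    where
    A B : ℕ
    A = prodExcept i (λ j → p ^ v j)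
    B = prodExcept i u
    pⱽ≡ : p ^ V ≡ p ^ v i * p ^ (V ∸ v i)
    pⱽ≡ = trans (cong (p ^_) (sym (m+[n∸m]≡n (v≤V i)))) (^-distribˡ-+-* p (v i) (V ∸ v i))
    Apᵛⁱ≡pˢ : A * p ^ v i ≡ p ^ sumF v
    Apᵛⁱ≡pˢ = trans (prodExcept*f≡prodF i (λ j → p ^ v j)) (prodF-^ p v)

infix 4 _^_∥_

record _^_∥_ (p k n : ℕ) : Set where
  constructor exact
  field
    pᵏ∣n : p ^ k ∣ n
    pᵏ⁺¹∤n : ¬ p ^ suc k ∣ n

open _^_∥_

^-monoʳ-∣ : ∀ m {a b} → a ≤ b → m ^ a ∣ m ^ b
^-monoʳ-∣ m {a} {b} a≤b = divides (m ^ (b ∸ a)) (begin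
  m ^ b              ≡⟨ cong (m ^_) (sym (m∸n+n≡m a≤b)) ⟩
  m ^ (b ∸ a + a)    ≡⟨ ^-distribˡ-+-* m (b ∸ a) a ⟩
  m ^ (b ∸ a) * m ^ a ∎)
  where open ≡-Reasoning

^∣∧^∤⇒≤ : ∀ m {a b n} → m ^ a ∣ n → ¬ m ^ suc b ∣ n → a ≤ b
^∣∧^∤⇒≤ m {a} {b} mᵃ∣n mᵇ⁺¹∤n with a ≤? b
... | yes a≤b = a≤b
... | no a≰b = contradiction (∣-trans (^-monoʳ-∣ m (≰⇒> a≰b)) mᵃ∣n) mᵇ⁺¹∤n

∥-unique : ∀ {p a b n} → p ^ a ∥ n → p ^ b ∥ n → a ≡ b
∥-unique {p} (exact pᵃ∣n pᵃ⁺¹∤n) (exact pᵇ∣n pᵇ⁺¹∤n) = ≤-antisym (^∣∧^∤⇒≤ p pᵃ∣n pᵇ⁺¹∤n) (^∣∧^∤⇒≤ p pᵇ∣n pᵃ⁺¹∤n)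

∤⇒^0∥ : ∀ {p n} → ¬ p ∣ n → p ^ 0 ∥ n
∤⇒^0∥ {p} {n} p∤n = exact (1∣ n) λ p*1∣n → p∤n (subst (_∣ n) (*-identityʳ p) p*1∣n)

∥-suc : ∀ {p k m} .{{_ : NonZero p}} → p ^ k ∥ m → p ^ suc k ∥ p * m
∥-suc {p} (exact pᵏ∣m pᵏ⁺¹∤m) = exact (*-monoʳ-∣ p pᵏ∣m) λ pᵏ⁺²∣pm → pᵏ⁺¹∤m (*-cancelˡ-∣ p pᵏ⁺²∣pm)

^*∥ : ∀ {p m} k .{{_ : NonZero p}} → ¬ p ∣ m → p ^ k ∥ p ^ k * m
^*∥ {p} {m} zero p∤m = ∤⇒^0∥ (subst (λ n → ¬ p ∣ n) (sym (*-identityˡ m)) p∤m)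
^*∥ {p} {m} (suc k) p∤m = subst (p ^ suc k ∥_) (sym (*-assoc p (p ^ k) m)) (∥-suc (^*∥ k p∤m))

∥⇒^*∤ : ∀ {p k n} → p ^ k ∥ n → Σ ℕ λ m → n ≡ p ^ k * m × ¬ p ∣ m
∥⇒^*∤ {p} {k} (exact (divides m n≡m*pᵏ) pᵏ⁺¹∤n) = m , trans n≡m*pᵏ (*-comm m (p ^ k)) , p∤m
  where
  p∤m : ¬ p ∣ m
  p∤m p∣m = pᵏ⁺¹∤n (subst (p ^ suc k ∣_) (sym n≡m*pᵏ) (*-monoˡ-∣ (p ^ k) p∣m))

∥-* : ∀ {p a b m n} → Prime p → p ^ a ∥ m → p ^ b ∥ n → p ^ (a + b) ∥ m * n
∥-* {p} {a} {b} p-prime pᵃ∥m pᵇ∥n with ∥⇒^*∤ pᵃ∥m | ∥⇒^*∤ pᵇ∥n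
... | m′ , refl , p∤m′ | n′ , refl , p∤n′ =
  subst (p ^ (a + b) ∥_) regroup (^*∥ (a + b) {{prime⇒nonZero p-prime}} p∤m′*n′)
  where
  p∤m′*n′ : ¬ p ∣ m′ * n′
  p∤m′*n′ p∣m′n′ = [ p∤m′ , p∤n′ ]′ (euclidsLemma m′ n′ p-prime p∣m′n′)
  regroup : p ^ (a + b) * (m′ * n′) ≡ p ^ a * m′ * (p ^ b * n′)
  regroup = trans (cong (_* (m′ * n′)) (^-distribˡ-+-* p a b)) (*-interchange (p ^ a) (p ^ b) m′ n′)

∥-prodF : ∀ {n p} (v f : Fin n → ℕ) → Prime p → (∀ i → p ^ v i ∥ f i) → p ^ sumF v ∥ prodF f
∥-prodF {zero} v f p-prime _ = ∤⇒^0∥ (λ p∣1 → ¬prime[1] (subst Prime (∣1⇒≡1 p∣1) p-prime))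
∥-prodF {suc n} v f p-prime pᵛ∥f =
  ∥-* p-prime (pᵛ∥f zero) (∥-prodF (λ i → v (suc i)) (λ i → f (suc i)) p-prime (λ i → pᵛ∥f (suc i)))

-- Likewise vp p n runs a local worker on fuel n; the with-abstractions below
-- expose the recursive call with the fuel and argument as distinct variables,
-- which is what lets unification solve vp-worker and the fuel be generalised.
mutual
  vp-worker : ℕ → ℕ → ℕ → ℕ → ℕ
  vp-worker = _

  private
    solve-vp-worker : ∀ q n → vp (2 + q) (suc n) ≡ vp (2 + q) (suc n)
    solve-vp-worker q n with 2 + q ∣? suc n
    ... | no _ = refl
    ... | yes _ with suc n / (2 + q)
    ... | k with suc n
    ... | N = cong suc (worker-refl N n k)
      where
      worker-refl : ∀ N f k → vp-worker q N f k ≡ vp-worker q N f k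
      worker-refl N f k = refl

module _ {q : ℕ} where
  private
    P : ℕ
    P = 2 + q

  vp-worker-∥ : ∀ N f k → 0 < k → k ≤ f → P ^ vp-worker q N f k ∥ k
  vp-worker-∥ N (suc f) (suc k) _ (s≤s k≤f) with P ∣? suc k
  ... | no P∤k = ∤⇒^0∥ P∤k
  ... | yes P∣k = subst (P ^ suc (vp-worker q N f m) ∥_) P*m≡k (∥-suc (vp-worker-∥ N f m m>0 m≤f))
    where
    m : ℕ
    m = suc k / P
    P*m≡k : P * m ≡ suc k
    P*m≡k = trans (*-comm P m) (m/n*n≡m P∣k)
    m>0 : 0 < m
    m>0 = n≢0⇒n>0 λ m≡0 → 0≢1+n (trans (sym (*-zeroʳ P)) (trans (cong (P *_) (sym m≡0)) P*m≡k))
    m≤f : m ≤ f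
    m≤f = ≤-pred (≤-trans (m/n<m (suc k) P (s≤s (s≤s z≤n))) (s≤s k≤f))

  vp-∥ : ∀ {n} → 0 < n → P ^ vp P n ∥ n
  vp-∥ {n} n>0 = vp-worker-∥ n n n n>0 ≤-refl

  ∥⇒vp≡ : ∀ {k n} → 0 < n → P ^ k ∥ n → vp P n ≡ k
  ∥⇒vp≡ n>0 Pᵏ∥n = ∥-unique (vp-∥ n>0) Pᵏ∥n

  vp≡⇒∥ : ∀ {k n} → 0 < n → vp P n ≡ k → P ^ k ∥ n
  vp≡⇒∥ {n = n} n>0 vp≡k = subst (λ k → P ^ k ∥ n) vp≡k (vp-∥ n>0)

  vp-pfree-factorisation : ∀ {n} → 0 < n → n ≡ P ^ vp P n * pfree P n × ¬ P ∣ pfree P n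
  vp-pfree-factorisation {n} n>0 with ∥⇒^*∤ (vp-∥ n>0)
  ... | m , n≡Pᵛ*m , P∤m = trans n≡Pᵛ*m (cong (P ^ v *_) (sym pfree≡m)) , subst (¬_ ∘′ (P ∣_)) (sym pfree≡m) P∤m
    where
    v : ℕ
    v = vp P n
    pfree≡m : pfree P n ≡ m
    pfree≡m = trans (cong (λ t → _/_ t (P ^ v) {{m^n≢0 P v}}) n≡Pᵛ*m)
                    (trans (cong (λ t → _/_ t (P ^ v) {{m^n≢0 P v}}) (*-comm (P ^ v) m)) (m*n/n≡m m (P ^ v) {{m^n≢0 P v}}))

  module _ (P-prime : Prime P) {a b m n : ℕ} (Pᵃ∥m : P ^ a ∥ m) (n>0 : 0 < n) where
    ∥-cancelˡ : P ^ (a + b) ∥ m * n → P ^ b ∥ n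
    ∥-cancelˡ Pᵃ⁺ᵇ∥mn = subst (λ c → P ^ c ∥ n) vp≡b (vp-∥ n>0)
      where
      vp≡b : vp P n ≡ b
      vp≡b = +-cancelˡ-≡ a _ _ (∥-unique (∥-* P-prime Pᵃ∥m (vp-∥ n>0)) Pᵃ⁺ᵇ∥mn)

    ^∣-cancelˡ : P ^ (a + b) ∣ m * n → P ^ b ∣ n
    ^∣-cancelˡ Pᵃ⁺ᵇ∣mn = ∣-trans (^-monoʳ-∣ P b≤vp) (pᵏ∣n (vp-∥ n>0))
      where
      b≤vp : b ≤ vp P n
      b≤vp = +-cancelˡ-≤ a _ _ (^∣∧^∤⇒≤ P Pᵃ⁺ᵇ∣mn (pᵏ⁺¹∤n (∥-* P-prime Pᵃ∥m (vp-∥ n>0))))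

gcd[m+n,m]≡gcd[m,n] : ∀ m n → gcd (m + n) m ≡ gcd m n
gcd[m+n,m]≡gcd[m,n] m n = GCD.unique (gcd-GCD (m + n) m) (GCD.sym (GCD.step (gcd-GCD m n)))

module GcdValuation {q : ℕ} (P-prime : Prime (2 + q)) {Π e T s V : ℕ} (Pˢ∥Π : (2 + q) ^ s ∥ Π)
                   (e≡Pˢ⁻ⱽ*T : e ≡ (2 + q) ^ (s ∸ V) * T) (1≤V : 1 ≤ V) (V≤s : V ≤ s) where
  private
    P : ℕ
    P = 2 + q

    r : ℕ
    r = s ∸ V

    Pᵏ∣Π : ∀ {k} → k ≤ s → P ^ k ∣ Π
    Pᵏ∣Π k≤s = ∣-trans (^-monoʳ-∣ P k≤s) (pᵏ∣n Pˢ∥Π)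

    r<s : suc r ≤ s
    r<s = subst (suc r ≤_) (m∸n+n≡m V≤s) (subst (_≤ r + V) (+-comm r 1) (+-monoʳ-≤ r 1≤V))

    P∣T⇒Pʳ⁺¹∣e : P ∣ T → P ^ suc r ∣ e
    P∣T⇒Pʳ⁺¹∣e P∣T = subst (P ^ suc r ∣_) (sym e≡Pˢ⁻ⱽ*T)
                       (subst (_∣ P ^ r * T) (*-comm (P ^ r) P) (*-monoʳ-∣ (P ^ r) P∣T))

    Pʳ⁺¹∣e⇒P∣T : P ^ suc r ∣ e → P ∣ T
    Pʳ⁺¹∣e⇒P∣T Pʳ⁺¹∣e = *-cancelˡ-∣ (P ^ r) {{m^n≢0 P r}}
                          (subst₂ _∣_ (*-comm P (P ^ r)) e≡Pˢ⁻ⱽ*T Pʳ⁺¹∣e)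

  P∤T⇒Pˢ⁻ⱽ∥gcd[Π,e] : ¬ P ∣ T → P ^ (s ∸ V) ∥ gcd Π e
  P∤T⇒Pˢ⁻ⱽ∥gcd[Π,e] P∤T = exact
    (gcd-greatest (Pᵏ∣Π (m∸n≤m s V)) (subst (P ^ r ∣_) (sym e≡Pˢ⁻ⱽ*T) (m∣m*n T)))
    (λ Pʳ⁺¹∣gcd → P∤T (Pʳ⁺¹∣e⇒P∣T (∣-trans Pʳ⁺¹∣gcd (gcd[m,n]∣n Π e))))

  Pˢ⁻ⱽ∥gcd⇒P∤T : ∀ xm → P ^ (s ∸ V) ∥ gcd (Π + xm * e) (Π * xm) → ¬ P ∣ T
  Pˢ⁻ⱽ∥gcd⇒P∤T xm Pʳ∥gcd P∣T = pᵏ⁺¹∤n Pʳ∥gcd (gcd-greatest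
    (∣m∣n⇒∣m+n (Pᵏ∣Π r<s) (∣n⇒∣m*n xm (P∣T⇒Pʳ⁺¹∣e P∣T)))
    (∣m⇒∣m*n xm (Pᵏ∣Π r<s)))

  Pˢ⁺ⱽ∣gcd⇒P∤T : ∀ {xm} → 0 < xm → P ^ (s + V) ∣ gcd (Π + xm * e) (Π * xm) → ¬ P ∣ T
  Pˢ⁺ⱽ∣gcd⇒P∤T {xm} xm>0 Pˢ⁺ⱽ∣gcd P∣T = pᵏ⁺¹∤n Pˢ∥Π Pˢ⁺¹∣Π
    where
    Pⱽ∣xm : P ^ V ∣ xm
    Pⱽ∣xm = ^∣-cancelˡ P-prime Pˢ∥Π xm>0 (∣-trans Pˢ⁺ⱽ∣gcd (gcd[m,n]∣n (Π + xm * e) (Π * xm)))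
    V+[r+1]≡s+1 : V + suc r ≡ suc s
    V+[r+1]≡s+1 = trans (+-suc V r) (cong suc (m+[n∸m]≡n V≤s))
    Pˢ⁺¹∣xm*e : P ^ suc s ∣ xm * e
    Pˢ⁺¹∣xm*e = subst (λ k → P ^ k ∣ xm * e) V+[r+1]≡s+1
      (subst (_∣ xm * e) (sym (^-distribˡ-+-* P V (suc r))) (*-pres-∣ Pⱽ∣xm (P∣T⇒Pʳ⁺¹∣e P∣T)))
    Pˢ⁺¹∣Π+xm*e : P ^ suc s ∣ Π + xm * e
    Pˢ⁺¹∣Π+xm*e = ∣-trans (^-monoʳ-∣ P (subst (_≤ s + V) (+-comm s 1) (+-monoʳ-≤ s 1≤V)))
                          (∣-trans Pˢ⁺ⱽ∣gcd (gcd[m,n]∣m (Π + xm * e) (Π * xm)))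
    Pˢ⁺¹∣Π : P ^ suc s ∣ Π
    Pˢ⁺¹∣Π = ∣m+n∣m⇒∣n (subst (P ^ suc s ∣_) (+-comm Π (xm * e)) Pˢ⁺¹∣Π+xm*e) Pˢ⁺¹∣xm*e

  P∤T⇒Pˢ⁺ⱽ∥Π*L : ¬ P ∣ T → ∀ {L} → 0 < L → Π ≡ gcd Π e * L → P ^ (s + V) ∥ Π * L
  P∤T⇒Pˢ⁺ⱽ∥Π*L P∤T {L} L>0 Π≡gcd*L =
    ∥-* P-prime Pˢ∥Π (∥-cancelˡ P-prime (P∤T⇒Pˢ⁻ⱽ∥gcd[Π,e] P∤T) L>0 Pʳ⁺ⱽ∥gcd*L)
    where
    Pʳ⁺ⱽ∥gcd*L : P ^ (r + V) ∥ gcd Π e * L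
    Pʳ⁺ⱽ∥gcd*L = subst₂ (λ k n → P ^ k ∥ n) (sym (m∸n+n≡m V≤s)) Π≡gcd*L Pˢ∥Π

odd⇒>0 : ∀ {n} → Odd n → 0 < n
odd⇒>0 {zero} odd = contradiction (2 ∣0) odd
odd⇒>0 {suc n} odd = z<s

-- In the second Bézout form b E ≡ 1 (mod L), so t = b (L - 1) ≡ - b works.
coprime⇒∃inverse : ∀ {L E} → 0 < L → Coprime L E → ∃ λ t → L ∣ 1 + t * E
coprime⇒∃inverse {suc L-1} {E} _ L⊥E with coprime-Bézout L⊥E
... | Bézout.+- a t 1+tE≡aL = t , divides a 1+tE≡aL
... | Bézout.-+ a b 1+aL≡bE = b * L-1 , divides (1 + L-1 * a) (begin
  1 + b * L-1 * E           ≡⟨ cong (1 +_) (reassoc b L-1 E) ⟩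
  1 + L-1 * (b * E)         ≡⟨ cong (λ z → 1 + L-1 * z) (sym 1+aL≡bE) ⟩
  1 + L-1 * (1 + a * suc L-1) ≡⟨ factor L-1 a ⟩
  (1 + L-1 * a) * suc L-1   ∎)
  where
  open ≡-Reasoning
  reassoc : ∀ b l E → b * l * E ≡ l * (b * E)
  reassoc = solve-∀
  factor : ∀ l a → 1 + l * (1 + a * suc l) ≡ (1 + l * a) * suc l
  factor = solve-∀

-- Shifting t by L keeps the congruence and flips the parity of t.
odd-inverse : ∀ {L E} t → Odd L → L ∣ 1 + t * E → ∃ λ t′ → Odd t′ × L ∣ 1 + t′ * E
odd-inverse {L} {E} t odd-L L∣1+tE with 2 ∣? t
... | no odd-t = t , odd-t , L∣1+tE
... | yes 2∣t = t + L , (λ 2∣t+L → odd-L (∣m+n∣m⇒∣n 2∣t+L 2∣t)) ,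
                subst (L ∣_) (sym (expand t L E)) (∣m∣n⇒∣m+n L∣1+tE (m∣m*n E))
  where
  expand : ∀ t L E → 1 + (t + L) * E ≡ (1 + t * E) + L * E
  expand = solve-∀

gcd[1+t*E,L*t]≡L : ∀ {L t E} → L ∣ 1 + t * E → gcd (1 + t * E) (L * t) ≡ L
gcd[1+t*E,L*t]≡L {L} {t} {E} L∣1+tE = ∣-antisym g∣L (gcd-greatest L∣1+tE (m∣m*n t))
  where
  g : ℕ
  g = gcd (1 + t * E) (L * t)
  1+tE⊥t : Coprime (1 + t * E) t
  1+tE⊥t {d} (d∣1+tE , d∣t) = ∣1⇒≡1 (∣m+n∣m⇒∣n (subst (d ∣_) (+-comm 1 (t * E)) d∣1+tE) (∣m⇒∣m*n E d∣t))
  g⊥t : Coprime g t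
  g⊥t (d∣g , d∣t) = 1+tE⊥t (∣-trans d∣g (gcd[m,n]∣m (1 + t * E) (L * t)) , d∣t)
  g∣L : g ∣ L
  g∣L = coprime-divisor g⊥t (subst (g ∣_) (*-comm L t) (gcd[m,n]∣n (1 + t * E) (L * t)))

Π+Lt*e≡Π*[1+tE] : ∀ {Π e} g L E t → Π ≡ g * L → e ≡ g * E → Π + L * t * e ≡ Π * (1 + t * E)
Π+Lt*e≡Π*[1+tE] {Π} {e} g L E t Π≡g*L e≡g*E = begin
  Π + L * t * e           ≡⟨ cong (λ z → Π + L * t * z) e≡g*E ⟩
  Π + L * t * (g * E)     ≡⟨ regroup Π L t g E ⟩
  Π + g * L * (t * E)     ≡⟨ cong (λ z → Π + z * (t * E)) (sym Π≡g*L) ⟩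
  Π + Π * (t * E)         ≡⟨ factor Π (t * E) ⟩
  Π * (1 + t * E)         ∎
  where
  open ≡-Reasoning
  regroup : ∀ Π L t g E → Π + L * t * (g * E) ≡ Π + g * L * (t * E)
  regroup = solve-∀
  factor : ∀ Π x → Π + Π * x ≡ Π * (1 + x)
  factor = solve-∀

∃odd-xm[gcd≡Π*cofactor] : ∀ {Π} e → 0 < Π → Odd Π →
  ∃ λ L → (0 < L × Π ≡ gcd Π e * L) ×
    ∃ λ xm → (Odd xm × 0 < xm) × gcd (Π + xm * e) (Π * xm) ≡ Π * L
∃odd-xm[gcd≡Π*cofactor] {Π} e Π>0 odd-Π =
  L , (L>0 , Π≡g*L) , L * t , (odd-L*t , *-mono-< L>0 (odd⇒>0 odd-t)) , gcd≡Π*L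
  where
  g : ℕ
  g = gcd Π e
  instance
    g≢0 : NonZero g
    g≢0 = >-nonZero (n≢0⇒n>0 (gcd[m,n]≢0 Π e (inj₁ (n>0⇒n≢0 Π>0))))
  L E : ℕ
  L = Π / g
  E = e / g
  Π≡g*L : Π ≡ g * L
  Π≡g*L = trans (sym (m/n*n≡m (gcd[m,n]∣m Π e))) (*-comm L g)
  e≡g*E : e ≡ g * E
  e≡g*E = trans (sym (m/n*n≡m (gcd[m,n]∣n Π e))) (*-comm E g)
  L>0 : 0 < L
  L>0 = n≢0⇒n>0 λ L≡0 → n>0⇒n≢0 Π>0 (trans Π≡g*L (trans (cong (g *_) L≡0) (*-zeroʳ g)))
  odd-L : Odd L
  odd-L 2∣L = odd-Π (subst (2 ∣_) (sym Π≡g*L) (∣n⇒∣m*n g 2∣L))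
  inverse : ∃ λ t → Odd t × L ∣ 1 + t * E
  inverse with coprime⇒∃inverse L>0 (coprime-/gcd Π e)
  ... | t₀ , L∣1+t₀E = odd-inverse t₀ odd-L L∣1+t₀E
  t : ℕ
  t = proj₁ inverse
  odd-t : Odd t
  odd-t = proj₁ (proj₂ inverse)
  odd-L*t : Odd (L * t)
  odd-L*t 2∣Lt = [ odd-L , odd-t ]′ (euclidsLemma L t prime[2] 2∣Lt)
  gcd≡Π*L : gcd (Π + L * t * e) (Π * (L * t)) ≡ Π * L
  gcd≡Π*L = begin
    gcd (Π + L * t * e) (Π * (L * t))       ≡⟨ cong (λ z → gcd z (Π * (L * t))) (Π+Lt*e≡Π*[1+tE] g L E t Π≡g*L e≡g*E) ⟩
    gcd (Π * (1 + t * E)) (Π * (L * t))     ≡⟨ sym (c*gcd[m,n]≡gcd[cm,cn] Π (1 + t * E) (L * t)) ⟩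
    Π * gcd (1 + t * E) (L * t)             ≡⟨ cong (Π *_) (gcd[1+t*E,L*t]≡L (proj₂ (proj₂ inverse))) ⟩
    Π * L                                    ∎
    where open ≡-Reasoning

module Equivalences {n} (x : Fin n → ℕ) (odd-x : ∀ i → Odd (x i) × 0 < x i) where
  Π e : ℕ
  Π = prodF x
  e = σprev x

  y : ℕ → ℕ
  y xm = gcd (σprev (snoc x xm)) (prodF (snoc x xm))

  S : ℕ → Set
  S p = Prime p × ∃ λ i → p ∣ x i

  T : ℕ → ℕ
  T p = sumF (λ i → p ^ (Vp p x ∸ vp p (x i)) * prodExcept i (λ j → pfree p (x j)))

  Cond-a Cond-b Cond-c : Set
  Cond-a = Σ ℕ λ xm → (Odd xm × 0 < xm) × (∀ p → S p → vp p (y xm) ≡ vp p Π ∸ Vp p x)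
  Cond-b = Σ ℕ λ xm → (Odd xm × 0 < xm) × (∀ p → S p → vp p (y xm) ≡ vp p Π + Vp p x)
  Cond-c = ∀ p → S p → ¬ p ∣ T p

  private
    x>0 : ∀ i → 0 < x i
    x>0 i = proj₂ (odd-x i)

    Π>0 : 0 < Π
    Π>0 = prodF-pos x x>0

    odd-Π : Odd Π
    odd-Π = prime∤prodF x prime[2] (λ i → proj₁ (odd-x i))

    y≡gcd : ∀ xm → y xm ≡ gcd (Π + xm * e) (Π * xm)
    y≡gcd xm = cong₂ gcd (σprev-snoc x xm) (prodF-snoc x xm)

    gcd>0 : ∀ {xm} → 0 < xm → 0 < gcd (Π + xm * e) (Π * xm)
    gcd>0 {xm} xm>0 = n≢0⇒n>0 (gcd[m,n]≢0 (Π + xm * e) (Π * xm) (inj₂ (n>0⇒n≢0 (*-mono-< Π>0 xm>0))))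

  module AtPrime {q} (P-prime : Prime (2 + q)) {i} (P∣xᵢ : 2 + q ∣ x i) where
    P s V : ℕ
    P = 2 + q
    s = sumF (λ j → vp P (x j))
    V = Vp P x

    Pˢ∥Π : P ^ s ∥ Π
    Pˢ∥Π = ∥-prodF (λ j → vp P (x j)) x P-prime (λ j → vp-∥ (x>0 j))

    1≤V : 1 ≤ V
    1≤V = ≤-trans (^∣∧^∤⇒≤ P (subst (_∣ x i) (sym (*-identityʳ P)) P∣xᵢ) (pᵏ⁺¹∤n (vp-∥ (x>0 i))))
                  (≤-maxF (λ j → vp P (x j)) i)

    V≤s : V ≤ s
    V≤s = maxF≤sumF (λ j → vp P (x j))

    e≡Pˢ⁻ⱽ*T : e ≡ P ^ (s ∸ V) * T P
    e≡Pˢ⁻ⱽ*T = *-cancelʳ-≡ e _ (P ^ V) {{m^n≢0 P V}} (begin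
      e * P ^ V                   ≡⟨ cong (_* P ^ V) (σprev-cong (λ j → proj₁ (vp-pfree-factorisation (x>0 j)))) ⟩
      σprev (λ j → P ^ vp P (x j) * pfree P (x j)) * P ^ V
                                  ≡⟨ σprev-^* P (λ j → vp P (x j)) (λ j → pfree P (x j)) (≤-maxF (λ j → vp P (x j))) ⟩
      P ^ s * T P                 ≡⟨ cong (λ k → P ^ k * T P) (sym (m∸n+n≡m V≤s)) ⟩
      P ^ (s ∸ V + V) * T P       ≡⟨ cong (_* T P) (^-distribˡ-+-* P (s ∸ V) V) ⟩
      P ^ (s ∸ V) * P ^ V * T P   ≡⟨ shuffle (P ^ (s ∸ V)) (P ^ V) (T P) ⟩
      P ^ (s ∸ V) * T P * P ^ V   ∎)
      where
      open ≡-Reasoning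
      shuffle : ∀ a b c → a * b * c ≡ a * c * b
      shuffle = solve-∀

    open GcdValuation P-prime Pˢ∥Π e≡Pˢ⁻ⱽ*T 1≤V V≤s public

    vp[y]≡⇒∥ : ∀ {xm} (f : ℕ → ℕ) → 0 < xm → vp P (y xm) ≡ f (vp P Π) →
               P ^ f s ∥ gcd (Π + xm * e) (Π * xm)
    vp[y]≡⇒∥ {xm} f xm>0 vp[y]≡ =
      vp≡⇒∥ (gcd>0 xm>0) (trans (cong (vp P) (sym (y≡gcd xm))) (trans vp[y]≡ (cong f (∥⇒vp≡ Π>0 Pˢ∥Π))))

    ∥⇒vp[y]≡ : ∀ {xm} (f : ℕ → ℕ) → 0 < xm → P ^ f s ∥ gcd (Π + xm * e) (Π * xm) →
               vp P (y xm) ≡ f (vp P Π)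
    ∥⇒vp[y]≡ {xm} f xm>0 Pᶠ⁽ˢ⁾∥gcd =
      trans (cong (vp P) (y≡gcd xm)) (trans (∥⇒vp≡ (gcd>0 xm>0) Pᶠ⁽ˢ⁾∥gcd) (cong f (sym (∥⇒vp≡ Π>0 Pˢ∥Π))))

  -- No clauses for p = 0, 1 are needed: the coverage checker sees that Prime 0 and
  -- Prime 1 are uninhabited.
  a⇒c : Cond-a → Cond-c
  a⇒c (xm , (_ , xm>0) , vp[y]≡) (suc (suc q)) (P-prime , i , P∣xᵢ) =
    Pˢ⁻ⱽ∥gcd⇒P∤T xm (vp[y]≡⇒∥ (_∸ V) xm>0 (vp[y]≡ P (P-prime , i , P∣xᵢ)))
    where open AtPrime P-prime P∣xᵢ

  b⇒c : Cond-b → Cond-c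
  b⇒c (xm , (_ , xm>0) , vp[y]≡) (suc (suc q)) (P-prime , i , P∣xᵢ) =
    Pˢ⁺ⱽ∣gcd⇒P∤T xm>0 (pᵏ∣n (vp[y]≡⇒∥ (_+ V) xm>0 (vp[y]≡ P (P-prime , i , P∣xᵢ))))
    where open AtPrime P-prime P∣xᵢ

  c⇒a : Cond-c → Cond-a
  c⇒a P∤T = 1 , (1-odd , z<s) , vp[y₁]≡
    where
    1-odd : Odd 1
    1-odd 2∣1 = contradiction (∣1⇒≡1 2∣1) λ ()
    vp[y₁]≡ : ∀ p → S p → vp p (y 1) ≡ vp p Π ∸ Vp p x
    vp[y₁]≡ (suc (suc q)) (P-prime , i , P∣xᵢ) = ∥⇒vp[y]≡ (_∸ V) z<s
      (subst (P ^ (s ∸ V) ∥_) gcd[Π,e]≡y₁ (P∤T⇒Pˢ⁻ⱽ∥gcd[Π,e] (P∤T P (P-prime , i , P∣xᵢ))))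
      where
      open AtPrime P-prime P∣xᵢ
      gcd[Π,e]≡y₁ : gcd Π e ≡ gcd (Π + 1 * e) (Π * 1)
      gcd[Π,e]≡y₁ = sym (trans (cong₂ gcd (cong (Π +_) (*-identityˡ e)) (*-identityʳ Π)) (gcd[m+n,m]≡gcd[m,n] Π e))

  c⇒b : Cond-c → Cond-b
  c⇒b P∤T = case ∃odd-xm[gcd≡Π*cofactor] e Π>0 odd-Π of λ where
      (L , (L>0 , Π≡gcd*L) , xm , (odd-xm , xm>0) , gcd≡Π*L) →
        xm , (odd-xm , xm>0) , vp[y]≡ xm>0 L>0 Π≡gcd*L gcd≡Π*L
    where
    vp[y]≡ : ∀ {L xm} → 0 < xm → 0 < L → Π ≡ gcd Π e * L → gcd (Π + xm * e) (Π * xm) ≡ Π * L →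
             ∀ p → S p → vp p (y xm) ≡ vp p Π + Vp p x
    vp[y]≡ xm>0 L>0 Π≡gcd*L gcd≡Π*L (suc (suc q)) (P-prime , i , P∣xᵢ) = ∥⇒vp[y]≡ (_+ V) xm>0
      (subst (P ^ (s + V) ∥_) (sym gcd≡Π*L) (P∤T⇒Pˢ⁺ⱽ∥Π*L (P∤T P (P-prime , i , P∣xᵢ)) L>0 Π≡gcd*L))
      where open AtPrime P-prime P∣xᵢ

theorem4p10 : (n : ℕ) (x : Fin n → ℕ) →
    (∀ i → Odd (x i) × 0 < x i) →
    let y : ℕ → ℕ
        y xm = gcd (σprev (snoc x xm)) (prodF (snoc x xm))
        S : ℕ → Set
        S p = Prime p × ∃ λ i → p ∣ x i
    in
    ((Σ ℕ λ xm → (Odd xm × 0 < xm) ×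
        (∀ p → S p → vp p (y xm) ≡ vp p (prodF x) ∸ Vp p x))
      ⇔
     (Σ ℕ λ xm → (Odd xm × 0 < xm) ×
        (∀ p → S p → vp p (y xm) ≡ vp p (prodF x) + Vp p x)))
    ×
    ((Σ ℕ λ xm → (Odd xm × 0 < xm) ×
        (∀ p → S p → vp p (y xm) ≡ vp p (prodF x) ∸ Vp p x))
      ⇔
     (∀ p → S p →
        ¬ (p ∣ sumF (λ i → p ^ (Vp p x ∸ vp p (x i)) *
                             prodExcept i (λ j → pfree p (x j))))))
theorem4p10 n x odd-x = mk⇔ (c⇒b ∘′ a⇒c) (c⇒a ∘′ b⇒c) , mk⇔ a⇒c c⇒a
  where open Equivalences x odd-x
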